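{- Every finite series-parallel poset is both $d$-decomposable and $c$-decomposable.
   Context: Series-parallel posets are the posets obtained from one-element posets by repeatedly applying series composition $P*P'$ (disjoint union with every element of $P$ below every element of $P'$) and parallel composition $P+P'$ (disjoint union with no relations between the parts). A $k$-antichain (resp. $k$-chain) is a union of $k$ antichains (resp. $k$ disjoint chains); $d_k(P)$ (resp. $c_k(P)$) is the maximum size of a $k$-antichain (resp. $k$-chain). $P$ is $d$-decomposable if it has a partition into antichains $A_1,\dots,A_h$ ($h$ the height) with $|A_1\cup\dots\cup A_k|=d_k(P)$ for all $k$; $P$ is $c$-decomposable if it has a partition into chains $C_1,\dots,C_w$ ($w$ the width) with $|C_1\cup\dots\cup C_k|=c_k(P)$ for all $k$. -}

module Defs where

open import Data.Nat using (ℕ; zero; suc; _+_; _≤_)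
open import Data.Fin using (Fin; zero; suc; splitAt)
open import Data.Fin.Subset using (Subset; _∈_; _∪_; ⊥; ∣_∣; Nonempty)
open import Data.Sum using (_⊎_; inj₁; inj₂)
open import Data.Product using (Σ; ∃; _×_; _,_)
open import Data.Unit using (⊤)
open import Data.Empty renaming (⊥ to Empty)
open import Relation.Binary.PropositionalEquality using (_≡_; _≢_)
open import Relation.Nullary using (¬_)
open import Function using (_∘_)

-- SP n : a series-parallel poset on the carrier Fin n.
--   one       : the one-element poset
--   ser P P'  : series composition  P * P'  (elements of P below those of P')
--   par P P'  : parallel composition P + P'
-- Carrier of a composite is Fin (m + n); the first m elements belong
-- to the left part (via splitAt).

data SP : ℕ → Set where
  one : SP 1
  ser : ∀ {m n} → SP m → SP n → SP (m + n)
  par : ∀ {m n} → SP m → SP n → SP (m + n)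

Leq : ∀ {n} → SP n → Fin n → Fin n → Set
serLeq : ∀ {m n} → SP m → SP n → Fin m ⊎ Fin n → Fin m ⊎ Fin n → Set
parLeq : ∀ {m n} → SP m → SP n → Fin m ⊎ Fin n → Fin m ⊎ Fin n → Set

Leq one x y = x ≡ y
Leq (ser {m} s t) x y = serLeq s t (splitAt m x) (splitAt m y)
Leq (par {m} s t) x y = parLeq s t (splitAt m x) (splitAt m y)

serLeq s t (inj₁ a) (inj₁ b) = Leq s a b
serLeq s t (inj₂ a) (inj₂ b) = Leq t a b
serLeq s t (inj₁ a) (inj₂ b) = ⊤
serLeq s t (inj₂ a) (inj₁ b) = Empty

parLeq s t (inj₁ a) (inj₁ b) = Leq s a b
parLeq s t (inj₂ a) (inj₂ b) = Leq t a b
parLeq s t (inj₁ a) (inj₂ b) = Empty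
parLeq s t (inj₂ a) (inj₁ b) = Empty

module _ {n : ℕ} (R : Fin n → Fin n → Set) where

  IsChain : Subset n → Set
  IsChain S = ∀ x y → x ∈ S → y ∈ S → R x y ⊎ R y x

  IsAntichain : Subset n → Set
  IsAntichain S = ∀ x y → x ∈ S → y ∈ S → R x y → x ≡ y

  IsUnionOf : ∀ {k} → (Fin k → Subset n) → Subset n → Set
  IsUnionOf F S = ∀ x → (x ∈ S → ∃ λ i → x ∈ F i) × ((∃ λ i → x ∈ F i) → x ∈ S)

  PairwiseDisjoint : ∀ {k} → (Fin k → Subset n) → Set
  PairwiseDisjoint F = ∀ i j → i ≢ j → ∀ x → x ∈ F i → x ∈ F j → Empty

  IsKAntichain : ℕ → Subset n → Set
  IsKAntichain k S = Σ (Fin k → Subset n) λ F →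
    (∀ i → IsAntichain (F i)) × IsUnionOf F S

  IsKChain : ℕ → Subset n → Set
  IsKChain k S = Σ (Fin k → Subset n) λ F →
    (∀ i → IsChain (F i)) × PairwiseDisjoint F × IsUnionOf F S

  IsMaxSize : (Subset n → Set) → ℕ → Set
  IsMaxSize Q m = (∃ λ S → Q S × ∣ S ∣ ≡ m) × (∀ S → Q S → ∣ S ∣ ≤ m)

  Height : ℕ → Set
  Height h = IsMaxSize IsChain h

  Width : ℕ → Set
  Width w = IsMaxSize IsAntichain w

  IsDk : ℕ → ℕ → Set
  IsDk k m = IsMaxSize (IsKAntichain k) m

  IsCk : ℕ → ℕ → Set
  IsCk k m = IsMaxSize (IsKChain k) m

  IsPartition : ∀ {k} → (Fin k → Subset n) → Set
  IsPartition F = (∀ i → Nonempty (F i)) × PairwiseDisjoint F ×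
                  (∀ x → ∃ λ i → x ∈ F i)

prefixUnion : ∀ {n h} → (Fin h → Subset n) → ℕ → Subset n
prefixUnion {h = zero} F k = ⊥
prefixUnion {h = suc h} F zero = ⊥
prefixUnion {h = suc h} F (suc k) = F zero ∪ prefixUnion (F ∘ suc) k

module _ {n : ℕ} (R : Fin n → Fin n → Set) where

  DDecomposable : Set
  DDecomposable = Σ ℕ λ h → Height R h × Σ (Fin h → Subset n) λ A →
    (∀ i → IsAntichain R (A i)) × IsPartition R A ×
    (∀ k → 1 ≤ k → k ≤ h → IsDk R k ∣ prefixUnion A k ∣)

  CDecomposable : Set
  CDecomposable = Σ ℕ λ w → Width R w × Σ (Fin w → Subset n) λ C →
    (∀ i → IsChain R (C i)) × IsPartition R C ×
    (∀ k → 1 ≤ k → k ≤ w → IsCk R k ∣ prefixUnion C k ∣)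

module Submission where

-- Call a partition of a poset into antichains A₀, …, A_{h-1} together with a partition
-- into chains C₀, …, C_{w-1} a conjugate decomposition if the two size sequences are
-- conjugate: ∣C_j∣ = #{i | ∣A_i∣ > j} and ∣A_i∣ = #{j | ∣C_j∣ > i}.
--
-- (1) A conjugate decomposition certifies both properties.  A chain and an antichain
--     share at most one element, so a union of k antichains meets each C_j in at most
--     min(k, ∣C_j∣) points and has at most Σ_j min(k, ∣C_j∣) = ∣A₀∣ + … + ∣A_{k-1}∣
--     elements, the equality being conjugacy.  Hence A₀ ∪ … ∪ A_{k-1} is a maximum
--     k-antichain; dually for k-chains, and k = 1 identifies the height and the width.
-- (2) Every series-parallel poset has one, by induction on its construction.  For P * Q
--     the chains of P and Q are zipped (C_j ∪ C′_j) and the antichains are put side by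
--     side and sorted by size; zipping adds size sequences entrywise while putting side
--     by side adds their conjugates, so conjugacy is preserved.  P + Q is the same with
--     the roles of chains and antichains exchanged.

open import Defs
open import Data.Nat using (ℕ; zero; suc; _+_; _*_; _≤_; _<_; _⊓_; _<ᵇ_; z≤n; s≤s)
open import Data.Nat.Properties
open import Data.Nat.ListAction using (sum)
open import Data.Nat.ListAction.Properties using (sum-↭; sum-++)
open import Data.Bool using (Bool; true; false; _∨_; _∧_)
open import Data.List using (List; []; _∷_; map; length; _++_) renaming (lookup to lookupL)
open import Data.List.Properties using (map-++; map-cong; map-∘)
open import Data.List.Relation.Unary.All as All using (All; []; _∷_)
open import Data.List.Relation.Unary.All.Properties using (++⁺; map⁺)
open import Data.List.Relation.Unary.AllPairs using (AllPairs; []; _∷_)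
open import Data.List.Relation.Binary.Permutation.Propositional using (_↭_; ↭-sym; ↭-refl; ↭-trans; prep; swap)
open import Data.List.Relation.Binary.Permutation.Propositional.Properties using (All-resp-↭) renaming (map⁺ to ↭-map⁺)
open import Data.List.Membership.Propositional.Properties using (∈-lookup)
open import Data.Fin using (Fin; zero; suc; toℕ; splitAt; join)
open import Data.Fin.Properties using (toℕ-injective; join-splitAt) renaming (suc-injective to Fin-suc-injective)
open import Data.Vec using (lookup; []; _∷_; here; there) renaming (_++_ to _++ᵥ_)
open import Data.Vec.Properties using ([]=⇒lookup; lookup⇒[]=; lookup-replicate; lookup-zipWith; lookup-splitAt)
open import Data.Fin.Subset using (Subset; _∈_; _∉_; ∣_∣; ⊥; _∪_; _∩_; Nonempty; Empty)
open import Data.Fin.Subset.Properties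
  using (∉⊥; ∣⊥∣≡0; x∈p∪q⁻; x∈p∪q⁺; x∈p∩q⁻; x∈p∩q⁺; p∩q⊆q; p⊆q⇒∣p∣≤∣q∣; Empty-unique; nonempty?)
open import Data.Product using (∃; _×_; _,_; proj₁)
open import Data.Sum using (_⊎_; inj₁; inj₂; [_,_]′)
open import Data.Unit using (tt)
open import Data.Empty using () renaming (⊥-elim to absurd)
open import Relation.Binary.PropositionalEquality
open import Relation.Nullary using (yes; no)
open import Function using (_∘_)
open import Algebra.Properties.CommutativeSemigroup +-commutativeSemigroup using (interchange)
open import Algebra.Properties.CommutativeMonoid.Sum +-0-commutativeMonoid
  using (∑-distrib-+; ∑-comm; sum-cong-≗; sum-replicate-zero) renaming (sum to ∑)

bit : Bool → ℕ
bit true = 1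
bit false = 0

𝟙 : ∀ {n} → Subset n → Fin n → ℕ
𝟙 p x = bit (lookup p x)

∑-mono : ∀ {k} {f g : Fin k → ℕ} → (∀ i → f i ≤ g i) → ∑ f ≤ ∑ g
∑-mono {zero} f≤g = z≤n
∑-mono {suc k} f≤g = +-mono-≤ (f≤g zero) (∑-mono (f≤g ∘ suc))

∑-summand : ∀ {k} (f : Fin k → ℕ) i → f i ≤ ∑ f
∑-summand f zero = m≤m+n _ _
∑-summand f (suc i) = ≤-trans (∑-summand (f ∘ suc) i) (m≤n+m _ _)

∑-const-1 : ∀ k → ∑ (λ (_ : Fin k) → 1) ≡ k
∑-const-1 zero = refl
∑-const-1 (suc k) = cong suc (∑-const-1 k)

∑-sum-comm : ∀ {k} {A : Set} (f : A → Fin k → ℕ) (L : List A) →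
  ∑ (λ x → sum (map (λ a → f a x) L)) ≡ sum (map (λ a → ∑ (f a)) L)
∑-sum-comm {k} f [] = sum-replicate-zero k
∑-sum-comm f (a ∷ L) = trans (∑-distrib-+ (f a) _) (cong (∑ (f a) +_) (∑-sum-comm f L))

sum-map-* : ∀ {A : Set} a (g : A → ℕ) (L : List A) → sum (map (λ B → a * g B) L) ≡ a * sum (map g L)
sum-map-* a g [] = sym (*-zeroʳ a)
sum-map-* a g (B ∷ L) = trans (cong (a * g B +_) (sum-map-* a g L)) (sym (*-distribˡ-+ a (g B) _))

sum-map-mono : ∀ {A : Set} {f g : A → ℕ} {L : List A} → All (λ B → f B ≤ g B) L → sum (map f L) ≤ sum (map g L)
sum-map-mono [] = z≤n
sum-map-mono (f≤g ∷ fs≤gs) = +-mono-≤ f≤g (sum-map-mono fs≤gs)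

sum-map-+ : ∀ {A : Set} (f g : A → ℕ) (L : List A) → sum (map (λ B → f B + g B) L) ≡ sum (map f L) + sum (map g L)
sum-map-+ f g [] = refl
sum-map-+ f g (B ∷ L) = trans (cong (f B + g B +_) (sum-map-+ f g L)) (interchange (f B) (g B) _ _)

sum-map-zero : ∀ {A : Set} (L : List A) → sum (map (λ _ → 0) L) ≡ 0
sum-map-zero [] = refl
sum-map-zero (B ∷ L) = sum-map-zero L

sum-map-∘ : ∀ {A B : Set} {f : A → B} {g : B → ℕ} {h : A → ℕ} → (∀ a → g (f a) ≡ h a) →
  ∀ (L : List A) → sum (map g (map f L)) ≡ sum (map h L)
sum-map-∘ gf≗h L = cong sum (trans (sym (map-∘ L)) (map-cong gf≗h L))

-- The sum  f 0 + … + f (k-1)  of an ℕ-indexed sequence; it unfolds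
-- definitionally as  f 0 + prefixSum k (f ∘ suc).
prefixSum : ℕ → (ℕ → ℕ) → ℕ
prefixSum k f = ∑ (λ (i : Fin k) → f (toℕ i))

prefixSum-cong : ∀ k {f g : ℕ → ℕ} → (∀ j → f j ≡ g j) → prefixSum k f ≡ prefixSum k g
prefixSum-cong k f≡g = sum-cong-≗ {k} (f≡g ∘ toℕ)

prefixSum-suc : ∀ k f → prefixSum (suc k) f ≡ prefixSum k f + f k
prefixSum-suc zero f = +-comm (f 0) 0
prefixSum-suc (suc k) f = trans (cong (f 0 +_) (prefixSum-suc k (f ∘ suc))) (sym (+-assoc (f 0) _ _))

∈⇒𝟙≡1 : ∀ {n} {p : Subset n} {x} → x ∈ p → 𝟙 p x ≡ 1
∈⇒𝟙≡1 x∈p = cong bit ([]=⇒lookup x∈p)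

𝟙-cases : ∀ {n} (p : Subset n) x → 𝟙 p x ≡ 0 ⊎ x ∈ p
𝟙-cases p x with lookup p x in eq
... | true = inj₂ (lookup⇒[]= x p eq)
... | false = inj₁ refl

𝟙-⊥ : ∀ {n} (x : Fin n) → 𝟙 ⊥ x ≡ 0
𝟙-⊥ x = cong bit (lookup-replicate x false)

𝟙-∩ : ∀ {n} (p q : Subset n) x → 𝟙 (p ∩ q) x ≡ 𝟙 p x * 𝟙 q x
𝟙-∩ p q x rewrite lookup-zipWith _∧_ x p q with lookup p x | lookup q x
... | true | true = refl
... | true | false = refl
... | false | _ = refl

𝟙-∪ : ∀ {n} (p q : Subset n) x → 𝟙 p x + 𝟙 q x ≤ 1 → 𝟙 (p ∪ q) x ≡ 𝟙 p x + 𝟙 q x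
𝟙-∪ p q x h rewrite lookup-zipWith _∨_ x p q with lookup p x | lookup q x | h
... | true | true | s≤s ()
... | true | false | _ = refl
... | false | _ | _ = refl

∣∣≡∑𝟙 : ∀ {n} (p : Subset n) → ∣ p ∣ ≡ ∑ (𝟙 p)
∣∣≡∑𝟙 [] = refl
∣∣≡∑𝟙 (true ∷ p) = cong suc (∣∣≡∑𝟙 p)
∣∣≡∑𝟙 (false ∷ p) = ∣∣≡∑𝟙 p

∣∣≤1 : ∀ {n} (p : Subset n) → (∀ {x y} → x ∈ p → y ∈ p → x ≡ y) → ∣ p ∣ ≤ 1
∣∣≤1 [] same = z≤n
∣∣≤1 (false ∷ p) same = ∣∣≤1 p (λ x∈p y∈p → Fin-suc-injective (same (there x∈p) (there y∈p)))
∣∣≤1 {suc n} (true ∷ p) same = s≤s (≤-reflexive (trans (cong ∣_∣ (Empty-unique noOther)) (∣⊥∣≡0 n)))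
  where
    noOther : Empty p
    noOther (x , x∈p) with same here (there x∈p)
    ... | ()

∣∪∣-disjoint : ∀ {n} (p q : Subset n) → (∀ x → 𝟙 p x + 𝟙 q x ≤ 1) → ∣ p ∪ q ∣ ≡ ∣ p ∣ + ∣ q ∣
∣∪∣-disjoint p q disjoint = begin
  ∣ p ∪ q ∣                 ≡⟨ ∣∣≡∑𝟙 (p ∪ q) ⟩
  ∑ (𝟙 (p ∪ q))             ≡⟨ sum-cong-≗ (λ x → 𝟙-∪ p q x (disjoint x)) ⟩
  ∑ (λ x → 𝟙 p x + 𝟙 q x)   ≡⟨ ∑-distrib-+ (𝟙 p) (𝟙 q) ⟩
  ∑ (𝟙 p) + ∑ (𝟙 q)         ≡⟨ sym (cong₂ _+_ (∣∣≡∑𝟙 p) (∣∣≡∑𝟙 q)) ⟩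
  ∣ p ∣ + ∣ q ∣             ∎
  where open ≡-Reasoning

cover-bound : ∀ {n k} (S : Subset n) (F : Fin k → Subset n) →
  (∀ {x} → x ∈ S → ∃ λ i → x ∈ F i) → ∣ S ∣ ≤ ∑ (λ i → ∣ F i ∣)
cover-bound S F covered = begin
  ∣ S ∣                           ≡⟨ ∣∣≡∑𝟙 S ⟩
  ∑ (𝟙 S)                         ≤⟨ ∑-mono pointwise ⟩
  ∑ (λ x → ∑ (λ i → 𝟙 (F i) x))   ≡⟨ ∑-comm (λ x i → 𝟙 (F i) x) ⟩
  ∑ (λ i → ∑ (𝟙 (F i)))           ≡⟨ sum-cong-≗ (λ i → sym (∣∣≡∑𝟙 (F i))) ⟩
  ∑ (λ i → ∣ F i ∣)               ∎
  where
    open ≤-Reasoning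
    pointwise : ∀ x → 𝟙 S x ≤ ∑ (λ i → 𝟙 (F i) x)
    pointwise x with 𝟙-cases S x
    ... | inj₁ x∉S = ≤-trans (≤-reflexive x∉S) z≤n
    ... | inj₂ x∈S with covered x∈S
    ...   | i , x∈Fi = ≤-trans (≤-reflexive (trans (∈⇒𝟙≡1 x∈S) (sym (∈⇒𝟙≡1 x∈Fi))))
                               (∑-summand (λ i → 𝟙 (F i) x) i)

lookupOr : ∀ {A : Set} → A → List A → ℕ → A
lookupOr d [] i = d
lookupOr d (a ∷ L) zero = a
lookupOr d (a ∷ L) (suc i) = lookupOr d L i

nth : List ℕ → ℕ → ℕ
nth = lookupOr 0

lookupOr-map : ∀ {A B : Set} (f : A → B) {d : A} {d′ : B} → f d ≡ d′ →
  ∀ L i → lookupOr d′ (map f L) i ≡ f (lookupOr d L i)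
lookupOr-map f fd≡d′ [] i = sym fd≡d′
lookupOr-map f fd≡d′ (a ∷ L) zero = refl
lookupOr-map f fd≡d′ (a ∷ L) (suc i) = lookupOr-map f fd≡d′ L i

lookupOr-All : ∀ {A : Set} {P : A → Set} {d : A} {L : List A} → All P L → P d → ∀ i → P (lookupOr d L i)
lookupOr-All [] Pd i = Pd
lookupOr-All (Pa ∷ PL) Pd zero = Pa
lookupOr-All (Pa ∷ PL) Pd (suc i) = lookupOr-All PL Pd i

lookup-All : ∀ {A : Set} {P : A → Set} {L : List A} → All P L → ∀ i → P (lookupL L i)
lookup-All PL i = All.lookup PL (∈-lookup i)

lookup≡lookupOr : ∀ {A : Set} (d : A) (L : List A) (i : Fin (length L)) → lookupL L i ≡ lookupOr d L (toℕ i)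
lookup≡lookupOr d (a ∷ L) zero = refl
lookup≡lookupOr d (a ∷ L) (suc i) = lookup≡lookupOr d L i

module _ {n : ℕ} where

  block : List (Subset n) → ℕ → Subset n
  block = lookupOr ⊥

  sizes : List (Subset n) → List ℕ
  sizes = map ∣_∣

  mult : Fin n → List (Subset n) → ℕ
  mult x L = sum (map (λ B → 𝟙 B x) L)

  Tiles : List (Subset n) → Set
  Tiles L = ∀ x → mult x L ≡ 1

  ∈block⇒1≤mult : ∀ L a {x} → x ∈ block L a → 1 ≤ mult x L
  ∈block⇒1≤mult [] a x∈⊥ = absurd (∉⊥ x∈⊥)
  ∈block⇒1≤mult (B ∷ L) zero x∈B = ≤-trans (≤-reflexive (sym (∈⇒𝟙≡1 x∈B))) (m≤m+n _ _)
  ∈block⇒1≤mult (B ∷ L) (suc a) x∈L = ≤-trans (∈block⇒1≤mult L a x∈L) (m≤n+m _ _)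

  ∈two-blocks⇒2≤mult : ∀ L a b {x} → a ≢ b → x ∈ block L a → x ∈ block L b → 2 ≤ mult x L
  ∈two-blocks⇒2≤mult [] a b a≢b x∈⊥ _ = absurd (∉⊥ x∈⊥)
  ∈two-blocks⇒2≤mult (B ∷ L) zero zero a≢b _ _ = absurd (a≢b refl)
  ∈two-blocks⇒2≤mult (B ∷ L) zero (suc b) a≢b x∈B x∈L =
    +-mono-≤ (≤-reflexive (sym (∈⇒𝟙≡1 x∈B))) (∈block⇒1≤mult L b x∈L)
  ∈two-blocks⇒2≤mult (B ∷ L) (suc a) zero a≢b x∈L x∈B =
    +-mono-≤ (≤-reflexive (sym (∈⇒𝟙≡1 x∈B))) (∈block⇒1≤mult L a x∈L)
  ∈two-blocks⇒2≤mult (B ∷ L) (suc a) (suc b) a≢b x∈La x∈Lb =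
    ≤-trans (∈two-blocks⇒2≤mult L a b (a≢b ∘ cong suc) x∈La x∈Lb) (m≤n+m _ _)

  1≤mult⇒∈block : ∀ L {x} → 1 ≤ mult x L → ∃ λ (i : Fin (length L)) → x ∈ lookupL L i
  1≤mult⇒∈block (B ∷ L) {x} 1≤mult with 𝟙-cases B x
  ... | inj₂ x∈B = zero , x∈B
  ... | inj₁ x∉B with 1≤mult⇒∈block L (subst (λ v → 1 ≤ v + mult x L) x∉B 1≤mult)
  ...   | i , x∈Li = suc i , x∈Li

  tiles-disjoint : ∀ L → Tiles L → ∀ {a b x} → a ≢ b → x ∈ block L a → x ∉ block L b
  tiles-disjoint L tiles {x = x} a≢b x∈a x∈b =
    <-irrefl refl (subst (2 ≤_) (tiles x) (∈two-blocks⇒2≤mult L _ _ a≢b x∈a x∈b))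

  0<∣∣⇒nonempty : ∀ (p : Subset n) → 0 < ∣ p ∣ → Nonempty p
  0<∣∣⇒nonempty p 0<∣p∣ with nonempty? p
  ... | yes nonempty = nonempty
  ... | no empty = absurd (<-irrefl (sym (trans (cong ∣_∣ (Empty-unique empty)) (∣⊥∣≡0 n))) 0<∣p∣)

  tiles⇒partition : ∀ (R : Fin n → Fin n → Set) L → All (λ B → 0 < ∣ B ∣) L → Tiles L →
    IsPartition R (lookupL L)
  tiles⇒partition R L nonempty tiles =
    (λ i → 0<∣∣⇒nonempty _ (lookup-All nonempty i)) ,
    (λ i j i≢j x x∈i x∈j → tiles-disjoint L tiles (i≢j ∘ toℕ-injective)
       (subst (x ∈_) (lookup≡lookupOr ⊥ L i) x∈i) (subst (x ∈_) (lookup≡lookupOr ⊥ L j) x∈j)) ,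
    (λ x → 1≤mult⇒∈block L (≤-reflexive (sym (tiles x))))

  size-by-blocks : ∀ Bs → Tiles Bs → ∀ S → ∣ S ∣ ≡ sum (map (λ B → ∣ S ∩ B ∣) Bs)
  size-by-blocks Bs tiles S = begin
    ∣ S ∣                                        ≡⟨ ∣∣≡∑𝟙 S ⟩
    ∑ (𝟙 S)                                      ≡⟨ sum-cong-≗ split ⟩
    ∑ (λ x → sum (map (λ B → 𝟙 (S ∩ B) x) Bs))   ≡⟨ ∑-sum-comm (λ B → 𝟙 (S ∩ B)) Bs ⟩
    sum (map (λ B → ∑ (𝟙 (S ∩ B))) Bs)           ≡⟨ cong sum (map-cong (λ B → sym (∣∣≡∑𝟙 (S ∩ B))) Bs) ⟩
    sum (map (λ B → ∣ S ∩ B ∣) Bs)               ∎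
    where
      open ≡-Reasoning
      split : ∀ x → 𝟙 S x ≡ sum (map (λ B → 𝟙 (S ∩ B) x) Bs)
      split x = begin
        𝟙 S x                                    ≡⟨ sym (*-identityʳ _) ⟩
        𝟙 S x * 1                                ≡⟨ cong (𝟙 S x *_) (sym (tiles x)) ⟩
        𝟙 S x * mult x Bs                        ≡⟨ sym (sum-map-* (𝟙 S x) (λ B → 𝟙 B x) Bs) ⟩
        sum (map (λ B → 𝟙 S x * 𝟙 B x) Bs)       ≡⟨ cong sum (map-cong (λ B → sym (𝟙-∩ S B x)) Bs) ⟩
        sum (map (λ B → 𝟙 (S ∩ B) x) Bs)         ∎

  MeetAtMostOnce : Subset n → Subset n → Set
  MeetAtMostOnce S B = ∀ {x y} → x ∈ S → x ∈ B → y ∈ S → y ∈ B → x ≡ y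

  trace-bound : ∀ {k} S B (F : Fin k → Subset n) → (∀ {x} → x ∈ S → ∃ λ i → x ∈ F i) →
    (∀ i → MeetAtMostOnce (F i) B) → ∣ S ∩ B ∣ ≤ k ⊓ ∣ B ∣
  trace-bound {k} S B F covered once = ⊓-glb bounded-by-k (p⊆q⇒∣p∣≤∣q∣ (p∩q⊆q S B))
    where
      open ≤-Reasoning
      covered∩ : ∀ {x} → x ∈ S ∩ B → ∃ λ i → x ∈ F i ∩ B
      covered∩ x∈S∩B with x∈p∩q⁻ S B x∈S∩B
      ... | x∈S , x∈B with covered x∈S
      ...   | i , x∈Fi = i , x∈p∩q⁺ (x∈Fi , x∈B)
      single : ∀ i → ∣ F i ∩ B ∣ ≤ 1
      single i = ∣∣≤1 (F i ∩ B) λ {x} {y} x∈ y∈ →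
        let (x∈Fi , x∈B) = x∈p∩q⁻ (F i) B x∈ ; (y∈Fi , y∈B) = x∈p∩q⁻ (F i) B y∈
        in once i x∈Fi x∈B y∈Fi y∈B
      bounded-by-k : ∣ S ∩ B ∣ ≤ k
      bounded-by-k = begin
        ∣ S ∩ B ∣                ≤⟨ cover-bound (S ∩ B) (λ i → F i ∩ B) covered∩ ⟩
        ∑ (λ i → ∣ F i ∩ B ∣)    ≤⟨ ∑-mono single ⟩
        ∑ (λ (_ : Fin k) → 1)    ≡⟨ ∑-const-1 k ⟩
        k                        ∎

  greene-bound : ∀ {k} Bs → Tiles Bs → ∀ S (F : Fin k → Subset n) → (∀ {x} → x ∈ S → ∃ λ i → x ∈ F i) →
    All (λ B → ∀ i → MeetAtMostOnce (F i) B) Bs → ∣ S ∣ ≤ sum (map (k ⊓_) (sizes Bs))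
  greene-bound {k} Bs tiles S F covered once = begin
    ∣ S ∣                               ≡⟨ size-by-blocks Bs tiles S ⟩
    sum (map (λ B → ∣ S ∩ B ∣) Bs)      ≤⟨ sum-map-mono (All.map (trace-bound S _ F covered) once) ⟩
    sum (map (λ B → k ⊓ ∣ B ∣) Bs)      ≡⟨ cong sum (map-∘ Bs) ⟩
    sum (map (k ⊓_) (sizes Bs))         ∎
    where open ≤-Reasoning

  prefixUnion-⊆ : ∀ L k {x} → x ∈ prefixUnion (lookupL L) k → ∃ λ (i : Fin k) → x ∈ block L (toℕ i)
  prefixUnion-⊆ [] k x∈⊥ = absurd (∉⊥ x∈⊥)
  prefixUnion-⊆ (B ∷ L) zero x∈⊥ = absurd (∉⊥ x∈⊥)
  prefixUnion-⊆ (B ∷ L) (suc k) x∈∪ with x∈p∪q⁻ B _ x∈∪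
  ... | inj₁ x∈B = zero , x∈B
  ... | inj₂ x∈rest with prefixUnion-⊆ L k x∈rest
  ...   | i , x∈Li = suc i , x∈Li

  prefixUnion-⊇ : ∀ L k {x} (i : Fin k) → x ∈ block L (toℕ i) → x ∈ prefixUnion (lookupL L) k
  prefixUnion-⊇ [] k i x∈⊥ = absurd (∉⊥ x∈⊥)
  prefixUnion-⊇ (B ∷ L) (suc k) zero x∈B = x∈p∪q⁺ (inj₁ x∈B)
  prefixUnion-⊇ (B ∷ L) (suc k) (suc i) x∈Li = x∈p∪q⁺ {p = B} (inj₂ (prefixUnion-⊇ L k i x∈Li))

  prefixUnion-isUnion : ∀ (R : Fin n → Fin n → Set) L k →
    IsUnionOf R (λ (i : Fin k) → block L (toℕ i)) (prefixUnion (lookupL L) k)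
  prefixUnion-isUnion R L k x = prefixUnion-⊆ L k , λ { (i , x∈Li) → prefixUnion-⊇ L k i x∈Li }

  ∣prefixUnion∣ : ∀ L k → (∀ x → mult x L ≤ 1) → ∣ prefixUnion (lookupL L) k ∣ ≡ prefixSum k (nth (sizes L))
  ∣prefixUnion∣ [] k _ = trans (∣⊥∣≡0 n) (sym (sum-replicate-zero k))
  ∣prefixUnion∣ (B ∷ L) zero _ = ∣⊥∣≡0 n
  ∣prefixUnion∣ (B ∷ L) (suc k) mult≤1 = begin
    ∣ B ∪ rest ∣          ≡⟨ ∣∪∣-disjoint B rest disjoint ⟩
    ∣ B ∣ + ∣ rest ∣      ≡⟨ cong (∣ B ∣ +_) (∣prefixUnion∣ L k (λ x → ≤-trans (m≤n+m _ (𝟙 B x)) (mult≤1 x))) ⟩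
    ∣ B ∣ + prefixSum k (nth (sizes L)) ∎
    where
      open ≡-Reasoning
      rest : Subset n
      rest = prefixUnion (lookupL L) k
      rest≤mult : ∀ x → 𝟙 rest x ≤ mult x L
      rest≤mult x with 𝟙-cases rest x
      ... | inj₁ x∉rest = ≤-trans (≤-reflexive x∉rest) z≤n
      ... | inj₂ x∈rest with prefixUnion-⊆ L k x∈rest
      ...   | i , x∈Li = ≤-trans (≤-reflexive (∈⇒𝟙≡1 x∈rest)) (∈block⇒1≤mult L (toℕ i) x∈Li)
      disjoint : ∀ x → 𝟙 B x + 𝟙 rest x ≤ 1
      disjoint x = ≤-trans (+-monoʳ-≤ (𝟙 B x) (rest≤mult x)) (mult≤1 x)

-- Conjugate sequences of natural numbers.  exceeds j x is 1 if x > j and 0 otherwise,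
-- and countAbove j a counts the entries of a exceeding j.  a is the conjugate of c
-- when a_i = #{j | c_j > i} for all i: the Ferrers diagram of a is that of c transposed.
exceeds : ℕ → ℕ → ℕ
exceeds j x = bit (j <ᵇ x)

countAbove : ℕ → List ℕ → ℕ
countAbove j a = sum (map (exceeds j) a)

_IsConjugateOf_ : List ℕ → List ℕ → Set
a IsConjugateOf c = ∀ i → nth a i ≡ countAbove i c

Descending : List ℕ → Set
Descending = AllPairs (λ x y → y ≤ x)

exceeds-≤ : ∀ {j x} → x ≤ j → exceeds j x ≡ 0
exceeds-≤ {j} {zero} _ = refl
exceeds-≤ {suc j} {suc x} (s≤s x≤j) = exceeds-≤ {j} {x} x≤j

exceeds-< : ∀ {j x} → j < x → exceeds j x ≡ 1
exceeds-< {zero} {suc x} _ = refl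
exceeds-< {suc j} {suc x} (s≤s j<x) = exceeds-< {j} {x} j<x

exceeds≡0⇒≤ : ∀ {j x} → exceeds j x ≡ 0 → x ≤ j
exceeds≡0⇒≤ {j} {x} e with j <? x
... | yes j<x = absurd (1+n≢0 (trans (sym (exceeds-< j<x)) e))
... | no j≮x = ≮⇒≥ j≮x

suc-⊓ : ∀ k x → suc k ⊓ x ≡ k ⊓ x + exceeds k x
suc-⊓ zero zero = refl
suc-⊓ zero (suc x) = refl
suc-⊓ (suc k) zero = refl
suc-⊓ (suc k) (suc x) = cong suc (suc-⊓ k x)

prefixSum-exceeds : ∀ k x → prefixSum k (λ j → exceeds j x) ≡ k ⊓ x
prefixSum-exceeds zero x = refl
prefixSum-exceeds (suc k) zero = sum-replicate-zero k
prefixSum-exceeds (suc k) (suc x) = cong suc (prefixSum-exceeds k x)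

-- If a is the conjugate of c, then  Σ_j min(k, c_j) = a_0 + … + a_{k-1}:
-- both count the cells of the first k columns of the Ferrers diagram of c.
conjugate-prefixSum : ∀ a c → a IsConjugateOf c → ∀ k → sum (map (k ⊓_) c) ≡ prefixSum k (nth a)
conjugate-prefixSum a c conj zero = sum-map-zero c
conjugate-prefixSum a c conj (suc k) = begin
  sum (map (suc k ⊓_) c)                       ≡⟨ cong sum (map-cong (suc-⊓ k) c) ⟩
  sum (map (λ x → k ⊓ x + exceeds k x) c)      ≡⟨ sum-map-+ (k ⊓_) (exceeds k) c ⟩
  sum (map (k ⊓_) c) + countAbove k c          ≡⟨ cong₂ _+_ (conjugate-prefixSum a c conj k) (sym (conj k)) ⟩
  prefixSum k (nth a) + nth a k                ≡⟨ sym (prefixSum-suc k (nth a)) ⟩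
  prefixSum (suc k) (nth a)                    ∎
  where open ≡-Reasoning

countAbove≡0⇒nth≤ : ∀ {j} a → countAbove j a ≡ 0 → ∀ i → nth a i ≤ j
countAbove≡0⇒nth≤ [] _ i = z≤n
countAbove≡0⇒nth≤ (x ∷ a) e zero = exceeds≡0⇒≤ (m+n≡0⇒m≡0 _ e)
countAbove≡0⇒nth≤ (x ∷ a) e (suc i) = countAbove≡0⇒nth≤ a (m+n≡0⇒n≡0 _ e) i

nth-beyond : ∀ c → nth c (length c) ≡ 0
nth-beyond [] = refl
nth-beyond (x ∷ c) = nth-beyond c

countAbove-as-prefixSum : ∀ i c → countAbove i c ≡ prefixSum (length c) (λ j → exceeds i (nth c j))
countAbove-as-prefixSum i [] = refl
countAbove-as-prefixSum i (x ∷ c) = cong (exceeds i x +_) (countAbove-as-prefixSum i c)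

countAbove-bounded : ∀ {j} a → All (_≤ j) a → countAbove j a ≡ 0
countAbove-bounded [] [] = refl
countAbove-bounded (x ∷ a) (x≤j ∷ a≤j) = trans (cong (_+ countAbove _ a) (exceeds-≤ x≤j)) (countAbove-bounded a a≤j)

countAbove-exceeds : ∀ a → Descending a → ∀ i j → exceeds i (countAbove j a) ≡ exceeds j (nth a i)
countAbove-exceeds [] _ i j = refl
countAbove-exceeds (x ∷ a) (x≥a ∷ desc) i j with j <? x
... | yes j<x rewrite exceeds-< j<x = shifted i
  where
    shifted : ∀ i → exceeds i (suc (countAbove j a)) ≡ exceeds j (nth (x ∷ a) i)
    shifted zero = sym (exceeds-< j<x)
    shifted (suc i) = countAbove-exceeds a desc i j
... | no j≮x = trans (cong (exceeds i) (cong₂ _+_ (exceeds-≤ x≤j) (countAbove-bounded a (All.tail all≤j))))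
                     (sym (exceeds-≤ (lookupOr-All all≤j z≤n i)))
  where
    x≤j : x ≤ j
    x≤j = ≮⇒≥ j≮x
    all≤j : All (_≤ j) (x ∷ a)
    all≤j = x≤j ∷ All.map (λ y≤x → ≤-trans y≤x x≤j) x≥a

conjugate-symmetric : ∀ a c → Descending a → c IsConjugateOf a → a IsConjugateOf c
conjugate-symmetric a c desc conj i = sym (begin
  countAbove i c                                       ≡⟨ countAbove-as-prefixSum i c ⟩
  prefixSum (length c) (λ j → exceeds i (nth c j))     ≡⟨ prefixSum-cong (length c) (cong (exceeds i) ∘ conj) ⟩
  prefixSum (length c) (λ j → exceeds i (countAbove j a)) ≡⟨ prefixSum-cong (length c) (countAbove-exceeds a desc i) ⟩
  prefixSum (length c) (λ j → exceeds j (nth a i))     ≡⟨ prefixSum-exceeds (length c) (nth a i) ⟩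
  length c ⊓ nth a i                                   ≡⟨ m≥n⇒m⊓n≡n (countAbove≡0⇒nth≤ a aboveLength i) ⟩
  nth a i                                              ∎)
  where
    open ≡-Reasoning
    aboveLength : countAbove (length c) a ≡ 0
    aboveLength = trans (sym (conj (length c))) (nth-beyond c)

countAbove-0 : ∀ {n} (L : List (Subset n)) → All (λ B → 0 < ∣ B ∣) L → countAbove 0 (sizes L) ≡ length L
countAbove-0 [] [] = refl
countAbove-0 (B ∷ L) (0<∣B∣ ∷ nonempty) = cong₂ _+_ (exceeds-< 0<∣B∣) (countAbove-0 L nonempty)

record ConjugateTilings {n : ℕ} (𝒳 𝒴 : Subset n → Set) : Set where
  field
    X Y : List (Subset n)
    X-blocks : All 𝒳 X
    Y-blocks : All 𝒴 Y
    X-nonempty : All (λ B → 0 < ∣ B ∣) X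
    Y-nonempty : All (λ B → 0 < ∣ B ∣) Y
    X-tiles : Tiles X
    Y-tiles : Tiles Y
    X-conj : sizes X IsConjugateOf sizes Y
    Y-conj : sizes Y IsConjugateOf sizes X

flip : ∀ {n} {𝒳 𝒴 : Subset n → Set} → ConjugateTilings 𝒳 𝒴 → ConjugateTilings 𝒴 𝒳
flip T = record
  { X = Y ; Y = X ; X-blocks = Y-blocks ; Y-blocks = X-blocks
  ; X-nonempty = Y-nonempty ; Y-nonempty = X-nonempty ; X-tiles = Y-tiles ; Y-tiles = X-tiles
  ; X-conj = Y-conj ; Y-conj = X-conj }
  where open ConjugateTilings T

module Optimality {n : ℕ} {𝒳 𝒴 : Subset n → Set}
  (meet : ∀ {S B} → 𝒳 S → 𝒴 B → MeetAtMostOnce S B) (T : ConjugateTilings 𝒳 𝒴) where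

  open ConjugateTilings T

  prefix-optimal : ∀ {k} S (F : Fin k → Subset n) → (∀ i → 𝒳 (F i)) →
    (∀ {x} → x ∈ S → ∃ λ i → x ∈ F i) → ∣ S ∣ ≤ ∣ prefixUnion (lookupL X) k ∣
  prefix-optimal {k} S F 𝒳F covered = begin
    ∣ S ∣                            ≤⟨ greene-bound Y Y-tiles S F covered meets ⟩
    sum (map (k ⊓_) (sizes Y))       ≡⟨ conjugate-prefixSum (sizes X) (sizes Y) X-conj k ⟩
    prefixSum k (nth (sizes X))      ≡⟨ sym (∣prefixUnion∣ X k (≤-reflexive ∘ X-tiles)) ⟩
    ∣ prefixUnion (lookupL X) k ∣    ∎
    where
      open ≤-Reasoning
      meets : All (λ B → ∀ i → MeetAtMostOnce (F i) B) Y
      meets = All.map (λ 𝒴B i {_} {_} → meet (𝒳F i) 𝒴B) Y-blocks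

  ∣largest-block∣ : nth (sizes X) 0 ≡ length Y
  ∣largest-block∣ = trans (X-conj 0) (countAbove-0 Y Y-nonempty)

  ∣first-block∣ : ∣ block X 0 ∣ ≡ length Y
  ∣first-block∣ = trans (sym (lookupOr-map ∣_∣ (∣⊥∣≡0 n) X 0)) ∣largest-block∣

  ∣first-prefix∣ : ∣ prefixUnion (lookupL X) 1 ∣ ≡ length Y
  ∣first-prefix∣ = trans (∣prefixUnion∣ X 1 (≤-reflexive ∘ X-tiles)) (trans (+-identityʳ _) ∣largest-block∣)

  single-bound : ∀ S → 𝒳 S → ∣ S ∣ ≤ length Y
  single-bound S 𝒳S = ≤-trans (prefix-optimal S (λ (_ : Fin 1) → S) (λ _ → 𝒳S) (λ x∈S → zero , x∈S))
                              (≤-reflexive ∣first-prefix∣)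

module _ {n : ℕ} (R : Fin n → Fin n → Set) where

  -- The empty set is both a chain and an antichain (it pads zipped lists).
  ∅-chain : IsChain R ⊥
  ∅-chain x y x∈⊥ = absurd (∉⊥ x∈⊥)

  ∅-antichain : IsAntichain R ⊥
  ∅-antichain x y x∈⊥ = absurd (∉⊥ x∈⊥)

  chain-meets-antichain : ∀ {S B} → IsChain R S → IsAntichain R B → MeetAtMostOnce S B
  chain-meets-antichain chain anti {x} {y} x∈S x∈B y∈S y∈B with chain x y x∈S y∈S
  ... | inj₁ x≤y = anti x y x∈B y∈B x≤y
  ... | inj₂ y≤x = sym (anti y x y∈B x∈B y≤x)

  antichain-meets-chain : ∀ {S B} → IsAntichain R S → IsChain R B → MeetAtMostOnce S B
  antichain-meets-chain anti chain x∈S x∈B y∈S y∈B = chain-meets-antichain chain anti x∈B x∈S y∈B y∈S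

  ConjugateDecomposition : Set
  ConjugateDecomposition = ConjugateTilings (IsAntichain R) (IsChain R)

  module Decompositions (T : ConjugateDecomposition) where

    open ConjugateTilings T renaming
      (X to A; Y to C; X-blocks to antichains; Y-blocks to chains; X-nonempty to A-nonempty;
       Y-nonempty to C-nonempty; X-tiles to A-tiles; Y-tiles to C-tiles)
    private
      module A-opt = Optimality antichain-meets-chain T
      module C-opt = Optimality chain-meets-antichain (flip T)

    first-k-antichains : ∀ k → IsDk R k ∣ prefixUnion (lookupL A) k ∣
    first-k-antichains k =
      (prefixUnion (lookupL A) k ,
        ((λ i → block A (toℕ i)) , (λ i → lookupOr-All antichains ∅-antichain (toℕ i)) , prefixUnion-isUnion R A k) ,
        refl) ,
      λ { S (F , F-antichains , union) → A-opt.prefix-optimal S F F-antichains (λ {x} → proj₁ (union x)) }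

    first-k-chains : ∀ k → IsCk R k ∣ prefixUnion (lookupL C) k ∣
    first-k-chains k =
      (prefixUnion (lookupL C) k ,
        ((λ i → block C (toℕ i)) , (λ i → lookupOr-All chains ∅-chain (toℕ i)) ,
         (λ i j i≢j x → tiles-disjoint C C-tiles (i≢j ∘ toℕ-injective)) , prefixUnion-isUnion R C k) ,
        refl) ,
      λ { S (F , F-chains , _ , union) → C-opt.prefix-optimal S F F-chains (λ {x} → proj₁ (union x)) }

    height : Height R (length A)
    height = (block C 0 , lookupOr-All chains ∅-chain 0 , C-opt.∣first-block∣) , C-opt.single-bound

    width : Width R (length C)
    width = (block A 0 , lookupOr-All antichains ∅-antichain 0 , A-opt.∣first-block∣) , A-opt.single-bound

    d-decomposable : DDecomposable R
    d-decomposable = length A , height , lookupL A , lookup-All antichains ,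
      tiles⇒partition R A A-nonempty A-tiles , λ k _ _ → first-k-antichains k

    c-decomposable : CDecomposable R
    c-decomposable = length C , width , lookupL C , lookup-All chains ,
      tiles⇒partition R C C-nonempty C-tiles , λ k _ _ → first-k-chains k

module SortByKey {A : Set} (key : A → ℕ) where

  insert : A → List A → List A
  insert a [] = a ∷ []
  insert a (b ∷ L) with key b ≤? key a
  ... | yes _ = a ∷ b ∷ L
  ... | no _ = b ∷ insert a L

  sort : List A → List A
  sort [] = []
  sort (a ∷ L) = insert a (sort L)

  insert-↭ : ∀ a L → insert a L ↭ a ∷ L
  insert-↭ a [] = ↭-refl
  insert-↭ a (b ∷ L) with key b ≤? key a
  ... | yes _ = ↭-refl
  ... | no _ = ↭-trans (prep b (insert-↭ a L)) (swap b a ↭-refl)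

  sort-↭ : ∀ L → sort L ↭ L
  sort-↭ [] = ↭-refl
  sort-↭ (a ∷ L) = ↭-trans (insert-↭ a (sort L)) (prep a (sort-↭ L))

  insert-bounded : ∀ {v} a L → key a ≤ v → All (_≤ v) (map key L) → All (_≤ v) (map key (insert a L))
  insert-bounded a [] a≤v [] = a≤v ∷ []
  insert-bounded a (b ∷ L) a≤v (b≤v ∷ L≤v) with key b ≤? key a
  ... | yes _ = a≤v ∷ b≤v ∷ L≤v
  ... | no _ = b≤v ∷ insert-bounded a L a≤v L≤v

  insert-descending : ∀ a L → Descending (map key L) → Descending (map key (insert a L))
  insert-descending a [] [] = [] ∷ []
  insert-descending a (b ∷ L) (b≥L ∷ desc) with key b ≤? key a
  ... | yes b≤a = (b≤a ∷ All.map (λ c≤b → ≤-trans c≤b b≤a) b≥L) ∷ b≥L ∷ desc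
  ... | no b≰a = insert-bounded a L (<⇒≤ (≰⇒> b≰a)) b≥L ∷ insert-descending a L desc

  sort-descending : ∀ L → Descending (map key (sort L))
  sort-descending [] = []
  sort-descending (a ∷ L) = insert-descending a (sort L) (sort-descending L)

module _ {m n : ℕ} where

  open SortByKey (∣_∣ {n = m + n}) using ()
    renaming (sort to sortBySize; sort-↭ to sortBySize-↭; sort-descending to sortBySize-descending)

  inl : Subset m → Subset (m + n)
  inl S = S ++ᵥ ⊥

  inr : Subset n → Subset (m + n)
  inr T = ⊥ ++ᵥ T

  zipU : List (Subset m) → List (Subset n) → List (Subset (m + n))
  zipU [] [] = []
  zipU (S ∷ L₁) [] = inl S ∷ zipU L₁ []
  zipU [] (T ∷ L₂) = inr T ∷ zipU [] L₂
  zipU (S ∷ L₁) (T ∷ L₂) = (S ++ᵥ T) ∷ zipU L₁ L₂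

  merge : List (Subset m) → List (Subset n) → List (Subset (m + n))
  merge L₁ L₂ = sortBySize (map inl L₁ ++ map inr L₂)

  Member : Subset m → Subset n → Fin m ⊎ Fin n → Set
  Member S T = [ (λ a → a ∈ S) , (λ b → b ∈ T) ]′

  ∈-++⁻ : ∀ {S T x} → x ∈ S ++ᵥ T → Member S T (splitAt m x)
  ∈-++⁻ {S} {T} {x} x∈ with splitAt m x | lookup-splitAt m S T x
  ... | inj₁ a | eq = lookup⇒[]= a S (trans (sym eq) ([]=⇒lookup x∈))
  ... | inj₂ b | eq = lookup⇒[]= b T (trans (sym eq) ([]=⇒lookup x∈))

  splitAt-injective : ∀ {x y} → splitAt m x ≡ splitAt m y → x ≡ y
  splitAt-injective {x} {y} eq = trans (sym (join-splitAt m n x)) (trans (cong (join m n) eq) (join-splitAt m n y))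

  𝟙-++ : ∀ (S : Subset m) (T : Subset n) x → 𝟙 (S ++ᵥ T) x ≡ [ 𝟙 S , 𝟙 T ]′ (splitAt m x)
  𝟙-++ S T x with splitAt m x | lookup-splitAt m S T x
  ... | inj₁ a | eq = cong bit eq
  ... | inj₂ b | eq = cong bit eq

  𝟙-++-split : ∀ (S : Subset m) (T : Subset n) x → 𝟙 (S ++ᵥ T) x ≡ 𝟙 (inl S) x + 𝟙 (inr T) x
  𝟙-++-split S T x = begin
    𝟙 (S ++ᵥ T) x                                       ≡⟨ 𝟙-++ S T x ⟩
    [ 𝟙 S , 𝟙 T ]′ (splitAt m x)                        ≡⟨ split (splitAt m x) ⟩
    [ 𝟙 S , 𝟙 ⊥ ]′ (splitAt m x) + [ 𝟙 ⊥ , 𝟙 T ]′ (splitAt m x)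
                                                        ≡⟨ sym (cong₂ _+_ (𝟙-++ S ⊥ x) (𝟙-++ ⊥ T x)) ⟩
    𝟙 (inl S) x + 𝟙 (inr T) x                           ∎
    where
      open ≡-Reasoning
      split : ∀ s → [ 𝟙 S , 𝟙 T ]′ s ≡ [ 𝟙 S , 𝟙 ⊥ ]′ s + [ 𝟙 ⊥ , 𝟙 T ]′ s
      split (inj₁ a) = sym (trans (cong (𝟙 S a +_) (𝟙-⊥ a)) (+-identityʳ _))
      split (inj₂ b) = sym (cong (_+ 𝟙 T b) (𝟙-⊥ b))

  ∣++∣ : ∀ {k} (S : Subset k) (T : Subset n) → ∣ S ++ᵥ T ∣ ≡ ∣ S ∣ + ∣ T ∣
  ∣++∣ [] T = refl
  ∣++∣ (true ∷ S) T = cong suc (∣++∣ S T)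
  ∣++∣ (false ∷ S) T = ∣++∣ S T

  ∣inl∣ : ∀ (S : Subset m) → ∣ inl S ∣ ≡ ∣ S ∣
  ∣inl∣ S = trans (∣++∣ S ⊥) (trans (cong (∣ S ∣ +_) (∣⊥∣≡0 n)) (+-identityʳ _))

  ∣inr∣ : ∀ (T : Subset n) → ∣ inr T ∣ ≡ ∣ T ∣
  ∣inr∣ T = trans (∣++∣ (⊥ {m}) T) (cong (_+ ∣ T ∣) (∣⊥∣≡0 m))

  0<∣inl∣ : ∀ {S : Subset m} → 0 < ∣ S ∣ → 0 < ∣ inl S ∣
  0<∣inl∣ {S} = subst (0 <_) (sym (∣inl∣ S))

  0<∣inr∣ : ∀ {T : Subset n} → 0 < ∣ T ∣ → 0 < ∣ inr T ∣
  0<∣inr∣ {T} = subst (0 <_) (sym (∣inr∣ T))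

  0<∣++∣ : ∀ {S : Subset m} {T : Subset n} → 0 < ∣ S ∣ → 0 < ∣ T ∣ → 0 < ∣ S ++ᵥ T ∣
  0<∣++∣ {S} {T} 0<∣S∣ _ = subst (0 <_) (sym (∣++∣ S T)) (≤-trans 0<∣S∣ (m≤m+n _ _))

  zipU-All : ∀ {P : Subset m → Set} {Q : Subset n → Set} {Z : Subset (m + n) → Set} →
    (∀ {S T} → P S → Q T → Z (S ++ᵥ T)) → (∀ {S} → P S → Z (inl S)) → (∀ {T} → Q T → Z (inr T)) →
    ∀ {L₁ L₂} → All P L₁ → All Q L₂ → All Z (zipU L₁ L₂)
  zipU-All both left right [] [] = []
  zipU-All both left right (p ∷ ps) [] = left p ∷ zipU-All both left right ps []
  zipU-All both left right [] (q ∷ qs) = right q ∷ zipU-All both left right [] qs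
  zipU-All both left right (p ∷ ps) (q ∷ qs) = both p q ∷ zipU-All both left right ps qs

  merge-All : ∀ {P : Subset m → Set} {Q : Subset n → Set} {Z : Subset (m + n) → Set} →
    (∀ {S} → P S → Z (inl S)) → (∀ {T} → Q T → Z (inr T)) →
    ∀ {L₁ L₂} → All P L₁ → All Q L₂ → All Z (merge L₁ L₂)
  merge-All left right {L₁} {L₂} ps qs =
    All-resp-↭ (↭-sym (sortBySize-↭ (map inl L₁ ++ map inr L₂)))
               (++⁺ (map⁺ (All.map left ps)) (map⁺ (All.map right qs)))

  -- Block multiplicities of zipU and merge: every zipped block S ++ T is the
  -- disjoint union of inl S and inr T, and merge permutes the lists of sides.
  mult-zipU : ∀ L₁ L₂ x → mult x (zipU L₁ L₂) ≡ mult x (map inl L₁) + mult x (map inr L₂)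
  mult-zipU [] [] x = refl
  mult-zipU (S ∷ L₁) [] x = trans (cong (𝟙 (inl S) x +_) (mult-zipU L₁ [] x))
                                  (sym (+-assoc (𝟙 (inl S) x) (mult x (map inl L₁)) 0))
  mult-zipU [] (T ∷ L₂) x = cong (𝟙 (inr T) x +_) (mult-zipU [] L₂ x)
  mult-zipU (S ∷ L₁) (T ∷ L₂) x =
    trans (cong₂ _+_ (𝟙-++-split S T x) (mult-zipU L₁ L₂ x))
          (interchange (𝟙 (inl S) x) (𝟙 (inr T) x) (mult x (map inl L₁)) (mult x (map inr L₂)))

  sum-merge : ∀ (g : Subset (m + n) → ℕ) L₁ L₂ →
    sum (map g (merge L₁ L₂)) ≡ sum (map g (map inl L₁)) + sum (map g (map inr L₂))
  sum-merge g L₁ L₂ = begin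
    sum (map g (merge L₁ L₂))                         ≡⟨ sum-↭ (↭-map⁺ g (sortBySize-↭ sides)) ⟩
    sum (map g (map inl L₁ ++ map inr L₂))            ≡⟨ cong sum (map-++ g (map inl L₁) (map inr L₂)) ⟩
    sum (map g (map inl L₁) ++ map g (map inr L₂))    ≡⟨ sum-++ (map g (map inl L₁)) _ ⟩
    sum (map g (map inl L₁)) + sum (map g (map inr L₂)) ∎
    where
      open ≡-Reasoning
      sides : List (Subset (m + n))
      sides = map inl L₁ ++ map inr L₂

  sides-tile : ∀ L₁ L₂ → Tiles L₁ → Tiles L₂ → ∀ x → mult x (map inl L₁) + mult x (map inr L₂) ≡ 1
  sides-tile L₁ L₂ tiles₁ tiles₂ x =
    trans (cong₂ _+_ (sum-map-∘ (λ S → 𝟙-++ S ⊥ x) L₁) (sum-map-∘ (λ T → 𝟙-++ ⊥ T x) L₂))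
          (by-side (splitAt m x))
    where
      padding : ∀ {A : Set} {k} (L : List A) (y : Fin k) → sum (map (λ _ → 𝟙 ⊥ y) L) ≡ 0
      padding L y = trans (cong sum (map-cong (λ _ → 𝟙-⊥ y) L)) (sum-map-zero L)
      by-side : ∀ s → sum (map (λ S → [ 𝟙 S , 𝟙 ⊥ ]′ s) L₁) + sum (map (λ T → [ 𝟙 ⊥ , 𝟙 T ]′ s) L₂) ≡ 1
      by-side (inj₁ a) = cong₂ _+_ (tiles₁ a) (padding L₂ a)
      by-side (inj₂ b) = cong₂ _+_ (padding L₁ b) (tiles₂ b)

  zipU-tiles : ∀ L₁ L₂ → Tiles L₁ → Tiles L₂ → Tiles (zipU L₁ L₂)
  zipU-tiles L₁ L₂ tiles₁ tiles₂ x = trans (mult-zipU L₁ L₂ x) (sides-tile L₁ L₂ tiles₁ tiles₂ x)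

  merge-tiles : ∀ L₁ L₂ → Tiles L₁ → Tiles L₂ → Tiles (merge L₁ L₂)
  merge-tiles L₁ L₂ tiles₁ tiles₂ x = trans (sum-merge (λ B → 𝟙 B x) L₁ L₂) (sides-tile L₁ L₂ tiles₁ tiles₂ x)

  nth-zipU : ∀ L₁ L₂ j → nth (sizes (zipU L₁ L₂)) j ≡ nth (sizes L₁) j + nth (sizes L₂) j
  nth-zipU [] [] j = refl
  nth-zipU (S ∷ L₁) [] zero = trans (∣inl∣ S) (sym (+-identityʳ _))
  nth-zipU (S ∷ L₁) [] (suc j) = nth-zipU L₁ [] j
  nth-zipU [] (T ∷ L₂) zero = ∣inr∣ T
  nth-zipU [] (T ∷ L₂) (suc j) = nth-zipU [] L₂ j
  nth-zipU (S ∷ L₁) (T ∷ L₂) zero = ∣++∣ S T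
  nth-zipU (S ∷ L₁) (T ∷ L₂) (suc j) = nth-zipU L₁ L₂ j

  countAbove-merge : ∀ L₁ L₂ j → countAbove j (sizes (merge L₁ L₂)) ≡ countAbove j (sizes L₁) + countAbove j (sizes L₂)
  countAbove-merge L₁ L₂ j = begin
    countAbove j (sizes (merge L₁ L₂))                   ≡⟨ sum-map-∘ (λ _ → refl) (merge L₁ L₂) ⟩
    sum (map g (merge L₁ L₂))                            ≡⟨ sum-merge g L₁ L₂ ⟩
    sum (map g (map inl L₁)) + sum (map g (map inr L₂))  ≡⟨ cong₂ _+_ (sum-map-∘ (cong (exceeds j) ∘ ∣inl∣) L₁)
                                                                     (sum-map-∘ (cong (exceeds j) ∘ ∣inr∣) L₂) ⟩
    sum (map g L₁) + sum (map g L₂)                      ≡⟨ sym (cong₂ _+_ (sum-map-∘ (λ _ → refl) L₁)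
                                                                        (sum-map-∘ (λ _ → refl) L₂)) ⟩
    countAbove j (sizes L₁) + countAbove j (sizes L₂)    ∎
    where
      open ≡-Reasoning
      g : ∀ {k} → Subset k → ℕ
      g B = exceeds j ∣ B ∣

  -- Zipping adds the size sequences of X entrywise, merging
  -- adds their conjugates, so the new size sequences are again conjugate.
  combine : ∀ {𝒳₁ 𝒴₁ : Subset m → Set} {𝒳₂ 𝒴₂ : Subset n → Set} {𝒳 𝒴 : Subset (m + n) → Set} →
    (∀ {S T} → 𝒳₁ S → 𝒳₂ T → 𝒳 (S ++ᵥ T)) → 𝒳₁ ⊥ → 𝒳₂ ⊥ →
    (∀ {S} → 𝒴₁ S → 𝒴 (inl S)) → (∀ {T} → 𝒴₂ T → 𝒴 (inr T)) →
    ConjugateTilings 𝒳₁ 𝒴₁ → ConjugateTilings 𝒳₂ 𝒴₂ → ConjugateTilings 𝒳 𝒴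
  combine 𝒳-++ 𝒳₁-∅ 𝒳₂-∅ 𝒴-inl 𝒴-inr T₁ T₂ = record
    { X = zipU X₁ X₂
    ; Y = merge Y₁ Y₂
    ; X-blocks = zipU-All 𝒳-++ (λ 𝒳S → 𝒳-++ 𝒳S 𝒳₂-∅) (λ 𝒳T → 𝒳-++ 𝒳₁-∅ 𝒳T) X₁-blocks X₂-blocks
    ; Y-blocks = merge-All 𝒴-inl 𝒴-inr Y₁-blocks Y₂-blocks
    ; X-nonempty = zipU-All (λ {S} {T} → 0<∣++∣ {S} {T}) (λ {S} → 0<∣inl∣ {S}) (λ {T} → 0<∣inr∣ {T})
                   X₁-nonempty X₂-nonempty
    ; Y-nonempty = merge-All (λ {S} → 0<∣inl∣ {S}) (λ {T} → 0<∣inr∣ {T}) Y₁-nonempty Y₂-nonempty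
    ; X-tiles = zipU-tiles X₁ X₂ X₁-tiles X₂-tiles
    ; Y-tiles = merge-tiles Y₁ Y₂ Y₁-tiles Y₂-tiles
    ; X-conj = X-conj′
    ; Y-conj = conjugate-symmetric (sizes (merge Y₁ Y₂)) (sizes (zipU X₁ X₂))
                 (sortBySize-descending (map inl Y₁ ++ map inr Y₂)) X-conj′
    }
    where
      open ConjugateTilings T₁ renaming (X to X₁; Y to Y₁; X-blocks to X₁-blocks; Y-blocks to Y₁-blocks;
        X-nonempty to X₁-nonempty; Y-nonempty to Y₁-nonempty; X-tiles to X₁-tiles; Y-tiles to Y₁-tiles;
        X-conj to X₁-conj; Y-conj to Y₁-conj)
      open ConjugateTilings T₂ renaming (X to X₂; Y to Y₂; X-blocks to X₂-blocks; Y-blocks to Y₂-blocks;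
        X-nonempty to X₂-nonempty; Y-nonempty to Y₂-nonempty; X-tiles to X₂-tiles; Y-tiles to Y₂-tiles;
        X-conj to X₂-conj; Y-conj to Y₂-conj)
      X-conj′ : sizes (zipU X₁ X₂) IsConjugateOf sizes (merge Y₁ Y₂)
      X-conj′ j = trans (nth-zipU X₁ X₂ j)
                        (trans (cong₂ _+_ (X₁-conj j) (X₂-conj j)) (sym (countAbove-merge Y₁ Y₂ j)))

  lift-chain : ∀ {S T} (Rs : Fin m ⊎ Fin n → Fin m ⊎ Fin n → Set) →
    (∀ u v → Member S T u → Member S T v → Rs u v ⊎ Rs v u) →
    IsChain (λ x y → Rs (splitAt m x) (splitAt m y)) (S ++ᵥ T)
  lift-chain Rs comparable x y x∈ y∈ = comparable _ _ (∈-++⁻ x∈) (∈-++⁻ y∈)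

  lift-antichain : ∀ {S T} (Rs : Fin m ⊎ Fin n → Fin m ⊎ Fin n → Set) →
    (∀ u v → Member S T u → Member S T v → Rs u v → u ≡ v) →
    IsAntichain (λ x y → Rs (splitAt m x) (splitAt m y)) (S ++ᵥ T)
  lift-antichain Rs incomparable x y x∈ y∈ x≤y = splitAt-injective (incomparable _ _ (∈-++⁻ x∈) (∈-++⁻ y∈) x≤y)

module _ {m n : ℕ} (P : SP m) (Q : SP n) where

  ser-chain : ∀ {S T} → IsChain (Leq P) S → IsChain (Leq Q) T → IsChain (Leq (ser P Q)) (S ++ᵥ T)
  ser-chain {S} {T} chainS chainT = lift-chain (serLeq P Q) comparable
    where
      comparable : ∀ u v → Member S T u → Member S T v → serLeq P Q u v ⊎ serLeq P Q v u
      comparable (inj₁ a) (inj₁ b) a∈S b∈S = chainS a b a∈S b∈S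
      comparable (inj₁ a) (inj₂ b) _ _ = inj₁ tt
      comparable (inj₂ a) (inj₁ b) _ _ = inj₂ tt
      comparable (inj₂ a) (inj₂ b) a∈T b∈T = chainT a b a∈T b∈T

  ser-antichain-inl : ∀ {S} → IsAntichain (Leq P) S → IsAntichain (Leq (ser P Q)) (inl S)
  ser-antichain-inl {S} anti = lift-antichain (serLeq P Q) incomparable
    where
      incomparable : ∀ u v → Member S ⊥ u → Member S ⊥ v → serLeq P Q u v → u ≡ v
      incomparable (inj₁ a) (inj₁ b) a∈S b∈S a≤b = cong inj₁ (anti a b a∈S b∈S a≤b)
      incomparable (inj₁ a) (inj₂ b) _ b∈⊥ _ = absurd (∉⊥ b∈⊥)
      incomparable (inj₂ a) v a∈⊥ _ _ = absurd (∉⊥ a∈⊥)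

  ser-antichain-inr : ∀ {T} → IsAntichain (Leq Q) T → IsAntichain (Leq (ser P Q)) (inr T)
  ser-antichain-inr {T} anti = lift-antichain (serLeq P Q) incomparable
    where
      incomparable : ∀ u v → Member ⊥ T u → Member ⊥ T v → serLeq P Q u v → u ≡ v
      incomparable (inj₂ a) (inj₂ b) a∈T b∈T a≤b = cong inj₂ (anti a b a∈T b∈T a≤b)
      incomparable (inj₂ a) (inj₁ b) _ b∈⊥ _ = absurd (∉⊥ b∈⊥)
      incomparable (inj₁ a) v a∈⊥ _ _ = absurd (∉⊥ a∈⊥)

  par-antichain : ∀ {S T} → IsAntichain (Leq P) S → IsAntichain (Leq Q) T → IsAntichain (Leq (par P Q)) (S ++ᵥ T)
  par-antichain {S} {T} antiS antiT = lift-antichain (parLeq P Q) incomparable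
    where
      incomparable : ∀ u v → Member S T u → Member S T v → parLeq P Q u v → u ≡ v
      incomparable (inj₁ a) (inj₁ b) a∈S b∈S a≤b = cong inj₁ (antiS a b a∈S b∈S a≤b)
      incomparable (inj₂ a) (inj₂ b) a∈T b∈T a≤b = cong inj₂ (antiT a b a∈T b∈T a≤b)
      incomparable (inj₁ a) (inj₂ b) _ _ ()
      incomparable (inj₂ a) (inj₁ b) _ _ ()

  par-chain-inl : ∀ {S} → IsChain (Leq P) S → IsChain (Leq (par P Q)) (inl S)
  par-chain-inl {S} chain = lift-chain (parLeq P Q) comparable
    where
      comparable : ∀ u v → Member S ⊥ u → Member S ⊥ v → parLeq P Q u v ⊎ parLeq P Q v u
      comparable (inj₁ a) (inj₁ b) a∈S b∈S = chain a b a∈S b∈S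
      comparable (inj₁ a) (inj₂ b) _ b∈⊥ = absurd (∉⊥ b∈⊥)
      comparable (inj₂ a) v a∈⊥ _ = absurd (∉⊥ a∈⊥)

  par-chain-inr : ∀ {T} → IsChain (Leq Q) T → IsChain (Leq (par P Q)) (inr T)
  par-chain-inr {T} chain = lift-chain (parLeq P Q) comparable
    where
      comparable : ∀ u v → Member ⊥ T u → Member ⊥ T v → parLeq P Q u v ⊎ parLeq P Q v u
      comparable (inj₂ a) (inj₂ b) a∈T b∈T = chain a b a∈T b∈T
      comparable (inj₂ a) (inj₁ b) _ b∈⊥ = absurd (∉⊥ b∈⊥)
      comparable (inj₁ a) v a∈⊥ _ = absurd (∉⊥ a∈⊥)

singleton-decomposition : ConjugateDecomposition (Leq one)
singleton-decomposition = record
  { X = whole ∷ [] ; Y = whole ∷ []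
  ; X-blocks = (λ { zero zero _ _ 0≡0 → 0≡0 }) ∷ [] ; Y-blocks = (λ { zero zero _ _ → inj₁ refl }) ∷ []
  ; X-nonempty = s≤s z≤n ∷ [] ; Y-nonempty = s≤s z≤n ∷ []
  ; X-tiles = λ { zero → refl } ; Y-tiles = λ { zero → refl }
  ; X-conj = self-conjugate ; Y-conj = self-conjugate }
  where
    whole : Subset 1
    whole = true ∷ []
    self-conjugate : sizes (whole ∷ []) IsConjugateOf sizes (whole ∷ [])
    self-conjugate zero = refl
    self-conjugate (suc j) = refl

-- Every series-parallel poset has a conjugate decomposition, by induction on its
-- construction: series composition zips chains and merges antichains, parallel
-- composition zips antichains and merges chains.
decomposition : ∀ {n} (P : SP n) → ConjugateDecomposition (Leq P)
decomposition one = singleton-decomposition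
decomposition (ser P Q) = flip (combine (ser-chain P Q) (∅-chain (Leq P)) (∅-chain (Leq Q))
  (ser-antichain-inl P Q) (ser-antichain-inr P Q) (flip (decomposition P)) (flip (decomposition Q)))
decomposition (par P Q) = combine (par-antichain P Q) (∅-antichain (Leq P)) (∅-antichain (Leq Q))
  (par-chain-inl P Q) (par-chain-inr P Q) (decomposition P) (decomposition Q)

mainTheorem5 : ∀ {n : ℕ} (P : SP n) → DDecomposable (Leq P) × CDecomposable (Leq P)
mainTheorem5 P = d-decomposable , c-decomposable
  where open Decompositions (Leq P) (decomposition P)
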